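{- Let $\Sigma$ be a set and $\alpha:X\to\mathcal{P}(\Sigma_\varepsilon\times X+1)$ an $\varepsilon$-NA. Let $\underline{\alpha}:X\to\mathcal{P}(\Sigma^{*}\times X+\Sigma^{*})$ be its translation, and define $\mathrm{tr}_{\underline{\alpha}}:X\to\mathcal{P}(\Sigma^{*})$ by $\mathrm{tr}_{\underline{\alpha}}=\bigvee_{n\in\mathbb{N}}\perp\cdot\underline{\alpha}^{n}$, where $\cdot$ and powers are taken in $\mathcal{K}l(\mathcal{P}(\Sigma^{*}\times\mathcal{I}d+\Sigma^{*}))$. Then $\mathrm{tr}_{\underline{\alpha}}$ coincides with the trace semantics morphism $\mathrm{tr}_\alpha$ of the $\varepsilon$-NA $\alpha$.
   Context: $\Sigma_\varepsilon=\Sigma+\{\varepsilon\}$, $1=\{\checkmark\}$, and $\Sigma^*$ is the set of finite words over $\Sigma$ with empty word $\varepsilon$. An $\varepsilon$-NA is a map $\alpha:X\to\mathcal{P}(\Sigma_\varepsilon\times X+1)$; write $x\xrightarrow{\sigma}x'$ for $(\sigma,x')\in\alpha(x)$; $x$ is final if $\checkmark\in\alpha(x)$. Its trace semantics $\mathrm{tr}_\alpha:X\to\mathcal{P}(\Sigma^*)$: $w\in\mathrm{tr}_\alpha(x)$ iff either $w=\varepsilon$ and $\checkmark\in\alpha(x)$, or $w=a_1\cdots a_n$ with $a_i\in\Sigma$ and there is $x'$ with $\checkmark\in\alpha(x')$ and $x\,(\xrightarrow{\varepsilon})^*\circ\xrightarrow{a_1}\circ(\xrightarrow{\varepsilon})^*\cdots(\xrightarrow{\varepsilon})^*\circ\xrightarrow{a_n}\circ(\xrightarrow{\varepsilon})^*\,x'$,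 where $R^*$ is reflexive–transitive closure. The translation is $\underline{\alpha}(x)=\{(a,y)\in\Sigma^*\times X\mid (a,y)\in\alpha(x)\}\cup A_x$, where letters $a\in\Sigma$ and $\varepsilon$ are regarded as words of length $\le1$ (so $(\varepsilon,y)\in\alpha(x)$ gives $(\varepsilon,y)\in\underline\alpha(x)$), and $A_x=\{\varepsilon\}$ if $\checkmark\in\alpha(x)$, else $\varnothing$. The monad $\mathcal{P}(\Sigma^*\times\mathcal{I}d+\Sigma^*)$ has Kleisli composition: for $f:X\to\mathcal{P}(\Sigma^*\times Y+\Sigma^*)$, $g:Y\to\mathcal{P}(\Sigma^*\times Z+\Sigma^*)$, $(g\cdot f)(x)=\{(s_1s_2,z)\mid (s_1,y)\in f(x),(s_2,z)\in g(y)\}\cup\{s_1s_2\mid (s_1,y)\in f(x), s_2\in g(y)\}\cup\{s_1\mid s_1\in f(x)\cap\Sigma^*\}$; the identity is $x\mapsto\{(\varepsilon,x)\}$, so $\underline\alpha^0$ is the identity. Morphisms $X\multimap\varnothing$ are maps $X\to\mathcal{P}(\Sigma^*)$; $\perp:X\to\mathcal{P}(\Sigma^*)$ is $x\mapsto\varnothing$, and $\bigvee$ is pointwise union. -}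

module Defs where

open import Data.Empty using (⊥)
open import Data.Unit using (⊤; tt)
open import Data.Maybe using (Maybe; just; nothing)
open import Data.List using (List; []; _∷_; _++_)
open import Data.Nat using (ℕ; zero; suc)
open import Data.Product using (_×_; _,_; ∃; ∃-syntax)
open import Data.Sum using (_⊎_; inj₁; inj₂)
open import Relation.Binary.PropositionalEquality using (_≡_)
open import Relation.Binary.Construct.Closure.ReflexiveTransitive using (Star)

𝒫 : Set → Set₁
𝒫 A = A → Set

-- Σ_ε = Σ + {ε}: `nothing` plays the role of ε.
Σε : Set → Set
Σε Σ = Maybe Σ

-- Σ_ε × X + 1   (inj₂ tt is the termination mark ✓)
NAStep : Set → Set → Set
NAStep Σ X = (Σε Σ × X) ⊎ ⊤

εNA : Set → Set → Set₁
εNA Σ X = X → 𝒫 (NAStep Σ X)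

module _ {Σ X : Set} (α : εNA Σ X) where

  εStep : X → X → Set
  εStep x y = α x (inj₁ (nothing , y))

  aStep : Σ → X → X → Set
  aStep a x y = α x (inj₁ (just a , y))

  final : X → Set
  final x = α x (inj₂ tt)

  Run : List Σ → X → X → Set
  Run [] x x' = Star εStep x x'
  Run (a ∷ w) x x' =
    ∃[ y ] ∃[ y' ] (Star εStep x y × aStep a y y' × Run w y' x')

  trα : X → 𝒫 (List Σ)
  trα x w = (w ≡ [] × final x) ⊎ (∃[ x' ] (final x' × Run w x x'))

-- Kleisli morphisms X ⇝ Y of the monad 𝒫(Σ* × Id + Σ*)
KlObj : Set → Set → Set
KlObj Σ Y = (List Σ × Y) ⊎ List Σ

_⇝[_]_ : Set → Set → Set → Set₁
X ⇝[ Σ ] Y = X → 𝒫 (KlObj Σ Y)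

module _ {Σ : Set} where

  ηK : {X : Set} → X ⇝[ Σ ] X
  ηK x (inj₁ (s , y)) = (s ≡ []) × (y ≡ x)
  ηK x (inj₂ s) = ⊥

  _·_ : {X Y Z : Set} → Y ⇝[ Σ ] Z → X ⇝[ Σ ] Y → X ⇝[ Σ ] Z
  (g · f) x (inj₁ (s , z)) =
    ∃[ s₁ ] ∃[ s₂ ] ∃[ y ] (s ≡ s₁ ++ s₂ × f x (inj₁ (s₁ , y)) × g y (inj₁ (s₂ , z)))
  (g · f) x (inj₂ s) =
    (∃[ s₁ ] ∃[ s₂ ] ∃[ y ] (s ≡ s₁ ++ s₂ × f x (inj₁ (s₁ , y)) × g y (inj₂ s₂)))
    ⊎ f x (inj₂ s)

  _^K_ : {X : Set} → X ⇝[ Σ ] X → ℕ → X ⇝[ Σ ] X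
  f ^K zero = ηK
  f ^K suc n = (f ^K n) · f

  ⊥K : {X : Set} → X ⇝[ Σ ] ⊥
  ⊥K x _ = ⊥

translate : {Σ X : Set} → εNA Σ X → X ⇝[ Σ ] X
translate α x (inj₁ (s , y)) =
  (s ≡ [] × α x (inj₁ (nothing , y)))
  ⊎ (∃[ a ] (s ≡ a ∷ [] × α x (inj₁ (just a , y))))
translate α x (inj₂ s) = s ≡ [] × α x (inj₂ tt)

-- Morphisms X ⇝ ∅ are identified with maps X → 𝒫(Σ*) via the Σ* summand.
asTrace : {Σ X : Set} → X ⇝[ Σ ] ⊥ → X → 𝒫 (List Σ)
asTrace f x w = f x (inj₂ w)

trTranslate : {Σ X : Set} → εNA Σ X → X → 𝒫 (List Σ)
trTranslate α x w = ∃[ n ] asTrace (⊥K · (translate α ^K n)) x w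

-- Each Kleisli step of α̲ either follows one ε- or letter-transition of α (recording the
-- letter) or terminates at a final state, and ⊥ · α̲ⁿ keeps only the terminating results.
-- So w ∈ (⊥ · α̲ⁿ)(x) for some n exactly when α has an ε*a₁ε*⋯aₙε* run from x to a final state.
module Submission where

open import Defs
open import Data.List using (List; []; _∷_)
open import Data.Nat using (ℕ; zero; suc)
open import Data.Product using (_,_; ∃-syntax)
open import Data.Sum using (inj₁; inj₂)
open import Function.Bundles using (_⇔_; mk⇔; Equivalence)
open import Relation.Binary.PropositionalEquality using (refl)
open import Relation.Binary.Construct.Closure.ReflexiveTransitive using (Star; ε; _◅_)

asTrace-⊥K· : {Σ X Y : Set} (f : X ⇝[ Σ ] Y) (x : X) (s : List Σ) →
              asTrace (⊥K · f) x s ⇔ f x (inj₂ s)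
asTrace-⊥K· f x s = mk⇔ (λ { (inj₁ (_ , _ , _ , _ , _ , ())) ; (inj₂ p) → p }) inj₂

module _ {Σ X : Set} (α : εNA Σ X) where

  AcceptsIn : ℕ → X → List Σ → Set
  AcceptsIn n x s = (translate α ^K n) x (inj₂ s)

  AcceptsIn-ε◅ : ∀ n {x y s} → εStep α x y → AcceptsIn n y s → AcceptsIn (suc n) x s
  AcceptsIn-ε◅ n {s = s} e p = inj₁ ([] , s , _ , refl , inj₁ (refl , e) , p)

  AcceptsIn-a◅ : ∀ n {a x y s} → aStep α a x y → AcceptsIn n y s → AcceptsIn (suc n) x (a ∷ s)
  AcceptsIn-a◅ n {a = a} {s = s} st p = inj₁ (a ∷ [] , s , _ , refl , inj₂ (a , refl , st) , p)

  AcceptsIn-final : ∀ {x} → final α x → AcceptsIn 1 x []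
  AcceptsIn-final f = inj₂ (refl , f)

  Accepts-ε* : ∀ {x y s} → Star (εStep α) x y → ∃[ n ] AcceptsIn n y s → ∃[ n ] AcceptsIn n x s
  Accepts-ε* ε q = q
  Accepts-ε* (e ◅ es) q with Accepts-ε* es q
  ... | n , p = suc n , AcceptsIn-ε◅ n e p

  Run-ε◅ : ∀ {x y x'} w → εStep α x y → Run α w y x' → Run α w x x'
  Run-ε◅ [] e r = e ◅ r
  Run-ε◅ (a ∷ w) e (y , y' , es , st , r) = y , y' , e ◅ es , st , r

  trα-ε◅ : ∀ {x y s} → εStep α x y → trα α y s → trα α x s
  trα-ε◅ e (inj₁ (refl , f)) = inj₂ (_ , f , e ◅ ε)
  trα-ε◅ e (inj₂ (x' , f , r)) = inj₂ (x' , f , Run-ε◅ _ e r)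

  trα-a◅ : ∀ {a x y s} → aStep α a x y → trα α y s → trα α x (a ∷ s)
  trα-a◅ st (inj₁ (refl , f)) = inj₂ (_ , f , _ , _ , ε , st , ε)
  trα-a◅ st (inj₂ (x' , f , r)) = inj₂ (x' , f , _ , _ , ε , st , r)

  trα-if-AcceptsIn : ∀ n {x s} → AcceptsIn n x s → trα α x s
  trα-if-AcceptsIn zero ()
  trα-if-AcceptsIn (suc n) (inj₂ (refl , f)) = inj₁ (refl , f)
  trα-if-AcceptsIn (suc n) (inj₁ (_ , _ , _ , refl , inj₁ (refl , e) , p)) =
    trα-ε◅ e (trα-if-AcceptsIn n p)
  trα-if-AcceptsIn (suc n) (inj₁ (_ , _ , _ , refl , inj₂ (_ , refl , st) , p)) =
    trα-a◅ st (trα-if-AcceptsIn n p)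

  Accepts-if-Run : ∀ w {x x'} → final α x' → Run α w x x' → ∃[ n ] AcceptsIn n x w
  Accepts-if-Run [] f es = Accepts-ε* es (1 , AcceptsIn-final f)
  Accepts-if-Run (a ∷ w) f (_ , _ , es , st , r) with Accepts-if-Run w f r
  ... | n , p = Accepts-ε* es (suc n , AcceptsIn-a◅ n st p)

  Accepts-if-trα : ∀ {x s} → trα α x s → ∃[ n ] AcceptsIn n x s
  Accepts-if-trα (inj₁ (refl , f)) = 1 , AcceptsIn-final f
  Accepts-if-trα (inj₂ (_ , f , r)) = Accepts-if-Run _ f r

theorem9 : {Σ X : Set} (α : εNA Σ X) (x : X) (w : List Σ) →
           trTranslate α x w ⇔ trα α x w
theorem9 α x w = mk⇔
  (λ { (n , q) → trα-if-AcceptsIn α n (to (terminal n) q) })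
  (λ t → let (n , p) = Accepts-if-trα α t in n , from (terminal n) p)
  where
  open Equivalence
  terminal : ∀ n → asTrace (⊥K · (translate α ^K n)) x w ⇔ AcceptsIn α n x w
  terminal n = asTrace-⊥K· (translate α ^K n) x w
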